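{- Let $m\ge1$ and let $a_1,\ldots,a_{2m}$ be positive integers. Then $$M^+(a_1,\ldots,a_{2m})=-M(d_1,\ldots,d_N),$$ where $(d_1,\ldots,d_N)$ is the sequence obtained by concatenating, in this order: the single entry $a_1+1$; then, for each $j=1,\ldots,m-1$, $(a_{2j}-1)$ copies of $2$ followed by the entry $a_{2j+1}+2$; then $a_{2m}$ copies of $2$; then the two entries $1,1$. That is, $$(d_1,\ldots,d_N)=\big(a_1+1,\underbrace{2,\ldots,2}_{a_2-1},a_3+2,\underbrace{2,\ldots,2}_{a_4-1},\ldots,a_{2m-1}+2,\underbrace{2,\ldots,2}_{a_{2m}},1,1\big).$$
   Context: For integers $c_1,\ldots,c_k$, $M(c_1,\ldots,c_k)=\prod_{i=1}^{k}\begin{pmatrix}c_i&-1\\1&0\end{pmatrix}$ and for integers $a_1,\ldots,a_{2m}$, $M^+(a_1,\ldots,a_{2m})=\prod_{i=1}^{2m}\begin{pmatrix}a_i&1\\1&0\end{pmatrix}$, products taken from left to right in increasing index. -}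

module Defs where

open import Data.Nat using (ℕ; zero; suc; _∸_)
open import Data.Integer using (ℤ; +_; -_; _+_; _*_; -1ℤ; 0ℤ; 1ℤ)
open import Data.List using (List; []; _∷_; _++_; replicate; foldr)

record Mat2 : Set where
  constructor mat
  field
    a b c d : ℤ

I₂ : Mat2
I₂ = mat 1ℤ 0ℤ 0ℤ 1ℤ

_⊗_ : Mat2 → Mat2 → Mat2
mat a b c d ⊗ mat a' b' c' d' =
  mat (a * a' + b * c') (a * b' + b * d') (c * a' + d * c') (c * b' + d * d')

negM : Mat2 → Mat2
negM (mat a b c d) = mat (- a) (- b) (- c) (- d)

M : List ℤ → Mat2
M = foldr (λ x acc → mat x -1ℤ 1ℤ 0ℤ ⊗ acc) I₂

M⁺ : List ℤ → Mat2
M⁺ = foldr (λ x acc → mat x 1ℤ 1ℤ 0ℤ ⊗ acc) I₂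

two : ℤ
two = + 2

-- tail of the d-sequence, given the current even-indexed entry a_{2j}
-- and the remaining entries a_{2j+1}, a_{2j+2}, ...
dTail : ℕ → List ℕ → List ℤ
dTail a2 [] = replicate a2 two ++ (1ℤ ∷ 1ℤ ∷ [])
dTail a2 (a3 ∷ []) = replicate a2 two ++ (1ℤ ∷ 1ℤ ∷ []) -- unreachable for even length
dTail a2 (a3 ∷ a4 ∷ rest) = replicate (a2 ∸ 1) two ++ ((+ a3 + two) ∷ dTail a4 rest)

dSeq : List ℕ → List ℤ
dSeq [] = []            -- unreachable (m ≥ 1)
dSeq (a1 ∷ []) = []     -- unreachable (even length)
dSeq (a1 ∷ a2 ∷ rest) = (+ a1 + 1ℤ) ∷ dTail a2 rest

-- Write B for the matrix ( 1 0 ; 1 -1 ).  The factors of M⁺ split as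
-- M⁺₁ x = M₁ (x + 1) · B, and B · M⁺₁ (1 + x) = M₁ 2 · B · M⁺₁ x, so that
-- B · M⁺₁ k = (M₁ 2)ᵏ · (M₁ 1)⁻¹.  Together with M₁ 2 · (M₁ 1)⁻¹ · M⁺₁ x = M₁ (x + 2) · B
-- this turns every block B · M⁺₁ a₂ⱼ · M⁺₁ a₂ⱼ₊₁ into (M₁ 2)^(a₂ⱼ - 1) · M₁ (a₂ⱼ₊₁ + 2) · B,
-- passing B on to the next block.  The last block is B · M⁺₁ a₂ₘ = (M₁ 2)^a₂ₘ · (M₁ 1)⁻¹,
-- and (M₁ 1)⁻¹ = -(M₁ 1)² because (M₁ 1)³ = -I; this is where the sign and the final 1, 1 come from.
module Submission where

open import Defs
open import Data.Nat using (ℕ; zero; suc; _*_; _≤_; _<_)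
open import Data.Nat.Properties using (*-comm)
open import Data.Integer as ℤ using (ℤ; +_; -_; -1ℤ; 0ℤ; 1ℤ)
open import Data.Integer.Tactic.RingSolver using (solve-∀)
open import Data.List using (List; []; _∷_; _++_; map; replicate)
open import Data.Vec using (Vec; toList; []; _∷_)
open import Data.Vec.Relation.Unary.All using (All; []; _∷_)
open import Relation.Binary.PropositionalEquality using (_≡_; refl; trans; cong; sym; module ≡-Reasoning)
open ≡-Reasoning

mat-cong : ∀ {a b c d a′ b′ c′ d′} → a ≡ a′ → b ≡ b′ → c ≡ c′ → d ≡ d′ →
           mat a b c d ≡ mat a′ b′ c′ d′
mat-cong refl refl refl refl = refl

⊗-assoc : ∀ X Y Z → (X ⊗ Y) ⊗ Z ≡ X ⊗ (Y ⊗ Z)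
⊗-assoc (mat a b c d) (mat e f g h) (mat i j k l) = mat-cong
  (entry a b e f g h i k) (entry a b e f g h j l) (entry c d e f g h i k) (entry c d e f g h j l)
  where
  entry : ∀ p q e f g h r s →
    (p ℤ.* e ℤ.+ q ℤ.* g) ℤ.* r ℤ.+ (p ℤ.* f ℤ.+ q ℤ.* h) ℤ.* s ≡
    p ℤ.* (e ℤ.* r ℤ.+ f ℤ.* s) ℤ.+ q ℤ.* (g ℤ.* r ℤ.+ h ℤ.* s)
  entry = solve-∀

⊗-identityˡ : ∀ X → I₂ ⊗ X ≡ X
⊗-identityˡ (mat a b c d) = mat-cong (entry a c) (entry b d) (entry′ a c) (entry′ b d)
  where
  entry : ∀ x y → 1ℤ ℤ.* x ℤ.+ 0ℤ ℤ.* y ≡ x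
  entry = solve-∀
  entry′ : ∀ x y → 0ℤ ℤ.* x ℤ.+ 1ℤ ℤ.* y ≡ y
  entry′ = solve-∀

⊗-identityʳ : ∀ X → X ⊗ I₂ ≡ X
⊗-identityʳ (mat a b c d) = mat-cong (entry a b) (entry′ a b) (entry c d) (entry′ c d)
  where
  entry : ∀ x y → x ℤ.* 1ℤ ℤ.+ y ℤ.* 0ℤ ≡ x
  entry = solve-∀
  entry′ : ∀ x y → x ℤ.* 0ℤ ℤ.+ y ℤ.* 1ℤ ≡ y
  entry′ = solve-∀

negM-distribʳ-⊗ : ∀ X Y → negM (X ⊗ Y) ≡ X ⊗ negM Y
negM-distribʳ-⊗ (mat a b c d) (mat e f g h) = mat-cong
  (entry a b e g) (entry a b f h) (entry c d e g) (entry c d f h)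
  where
  entry : ∀ p q r s → - (p ℤ.* r ℤ.+ q ℤ.* s) ≡ p ℤ.* - r ℤ.+ q ℤ.* - s
  entry = solve-∀

M₁ : ℤ → Mat2
M₁ c = mat c -1ℤ 1ℤ 0ℤ

M⁺₁ : ℤ → Mat2
M⁺₁ a = mat a 1ℤ 1ℤ 0ℤ

B : Mat2
B = mat 1ℤ 0ℤ 1ℤ -1ℤ

M₁[1]⁻¹ : Mat2
M₁[1]⁻¹ = mat 0ℤ 1ℤ -1ℤ 1ℤ

M-++ : ∀ xs ys → M (xs ++ ys) ≡ M xs ⊗ M ys
M-++ []       ys = sym (⊗-identityˡ (M ys))
M-++ (x ∷ xs) ys = begin
  M₁ x ⊗ M (xs ++ ys)   ≡⟨ cong (M₁ x ⊗_) (M-++ xs ys) ⟩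
  M₁ x ⊗ (M xs ⊗ M ys)  ≡⟨ sym (⊗-assoc (M₁ x) (M xs) (M ys)) ⟩
  (M₁ x ⊗ M xs) ⊗ M ys  ∎

M-replicate-suc : ∀ k x → M (replicate (suc k) x) ≡ M (replicate k x) ⊗ M₁ x
M-replicate-suc zero    x = trans (⊗-identityʳ (M₁ x)) (sym (⊗-identityˡ (M₁ x)))
M-replicate-suc (suc k) x = begin
  M₁ x ⊗ M (replicate (suc k) x)     ≡⟨ cong (M₁ x ⊗_) (M-replicate-suc k x) ⟩
  M₁ x ⊗ (M (replicate k x) ⊗ M₁ x)  ≡⟨ sym (⊗-assoc (M₁ x) (M (replicate k x)) (M₁ x)) ⟩
  M (replicate (suc k) x) ⊗ M₁ x     ∎

M⁺₁≡M₁⊗B : ∀ x → M⁺₁ x ≡ M₁ (x ℤ.+ 1ℤ) ⊗ B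
M⁺₁≡M₁⊗B x = mat-cong (entry-a x) (entry-b x) refl refl
  where
  entry-a : ∀ x → x ≡ (x ℤ.+ 1ℤ) ℤ.* 1ℤ ℤ.+ -1ℤ
  entry-a = solve-∀
  entry-b : ∀ x → 1ℤ ≡ (x ℤ.+ 1ℤ) ℤ.* 0ℤ ℤ.+ 1ℤ
  entry-b = solve-∀

B⊗M⁺₁-suc : ∀ x → B ⊗ M⁺₁ (1ℤ ℤ.+ x) ≡ M₁ two ⊗ (B ⊗ M⁺₁ x)
B⊗M⁺₁-suc x = mat-cong (entry-a x) refl (entry-c x) refl
  where
  entry-a : ∀ x → 1ℤ ℤ.* (1ℤ ℤ.+ x) ℤ.+ 0ℤ ≡
                  two ℤ.* (1ℤ ℤ.* x ℤ.+ 0ℤ) ℤ.+ -1ℤ ℤ.* (1ℤ ℤ.* x ℤ.+ -1ℤ)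
  entry-a = solve-∀
  entry-c : ∀ x → 1ℤ ℤ.* (1ℤ ℤ.+ x) ℤ.+ -1ℤ ≡
                  1ℤ ℤ.* (1ℤ ℤ.* x ℤ.+ 0ℤ) ℤ.+ 0ℤ ℤ.* (1ℤ ℤ.* x ℤ.+ -1ℤ)
  entry-c = solve-∀

M₁[2]⊗M₁[1]⁻¹⊗M⁺₁ : ∀ x → (M₁ two ⊗ M₁[1]⁻¹) ⊗ M⁺₁ x ≡ M₁ (x ℤ.+ two) ⊗ B
M₁[2]⊗M₁[1]⁻¹⊗M⁺₁ x = mat-cong (entry-a x) (entry-b x) refl refl
  where
  entry-a : ∀ x → 1ℤ ℤ.* x ℤ.+ 1ℤ ≡ (x ℤ.+ two) ℤ.* 1ℤ ℤ.+ -1ℤ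
  entry-a = solve-∀
  entry-b : ∀ x → 1ℤ ≡ (x ℤ.+ two) ℤ.* 0ℤ ℤ.+ 1ℤ
  entry-b = solve-∀

M⊗negM≡negM-M-++ : ∀ xs ys → M xs ⊗ negM (M ys) ≡ negM (M (xs ++ ys))
M⊗negM≡negM-M-++ xs ys = begin
  M xs ⊗ negM (M ys)   ≡⟨ sym (negM-distribʳ-⊗ (M xs) (M ys)) ⟩
  negM (M xs ⊗ M ys)   ≡⟨ cong negM (sym (M-++ xs ys)) ⟩
  negM (M (xs ++ ys))  ∎

B⊗M⁺₁ : ∀ k → B ⊗ M⁺₁ (+ k) ≡ M (replicate k two) ⊗ M₁[1]⁻¹
B⊗M⁺₁ zero    = refl
B⊗M⁺₁ (suc k) = begin
  B ⊗ M⁺₁ (+ suc k)                          ≡⟨ B⊗M⁺₁-suc (+ k) ⟩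
  M₁ two ⊗ (B ⊗ M⁺₁ (+ k))                   ≡⟨ cong (M₁ two ⊗_) (B⊗M⁺₁ k) ⟩
  M₁ two ⊗ (M (replicate k two) ⊗ M₁[1]⁻¹)  ≡⟨ sym (⊗-assoc (M₁ two) (M (replicate k two)) M₁[1]⁻¹) ⟩
  M (replicate (suc k) two) ⊗ M₁[1]⁻¹        ∎

B⊗M⁺₁[1+k] : ∀ k → B ⊗ M⁺₁ (+ suc k) ≡ M (replicate k two) ⊗ (M₁ two ⊗ M₁[1]⁻¹)
B⊗M⁺₁[1+k] k = begin
  B ⊗ M⁺₁ (+ suc k)                             ≡⟨ B⊗M⁺₁ (suc k) ⟩
  M (replicate (suc k) two) ⊗ M₁[1]⁻¹           ≡⟨ cong (_⊗ M₁[1]⁻¹) (M-replicate-suc k two) ⟩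
  (M (replicate k two) ⊗ M₁ two) ⊗ M₁[1]⁻¹      ≡⟨ ⊗-assoc (M (replicate k two)) (M₁ two) M₁[1]⁻¹ ⟩
  M (replicate k two) ⊗ (M₁ two ⊗ M₁[1]⁻¹)      ∎

B⊗M⁺₁⊗M⁺₁ : ∀ k x Y →
  B ⊗ (M⁺₁ (+ suc k) ⊗ (M⁺₁ x ⊗ Y)) ≡ M (replicate k two) ⊗ (M₁ (x ℤ.+ two) ⊗ (B ⊗ Y))
B⊗M⁺₁⊗M⁺₁ k x Y = begin
  B ⊗ (M⁺₁ (+ suc k) ⊗ (M⁺₁ x ⊗ Y))       ≡⟨ sym (⊗-assoc B (M⁺₁ (+ suc k)) (M⁺₁ x ⊗ Y)) ⟩
  (B ⊗ M⁺₁ (+ suc k)) ⊗ (M⁺₁ x ⊗ Y)       ≡⟨ cong (_⊗ (M⁺₁ x ⊗ Y)) (B⊗M⁺₁[1+k] k) ⟩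
  (T₂ᵏ ⊗ U) ⊗ (M⁺₁ x ⊗ Y)                 ≡⟨ ⊗-assoc T₂ᵏ U (M⁺₁ x ⊗ Y) ⟩
  T₂ᵏ ⊗ (U ⊗ (M⁺₁ x ⊗ Y))                 ≡⟨ cong (T₂ᵏ ⊗_) (sym (⊗-assoc U (M⁺₁ x) Y)) ⟩
  T₂ᵏ ⊗ ((U ⊗ M⁺₁ x) ⊗ Y)                 ≡⟨ cong (λ Z → T₂ᵏ ⊗ (Z ⊗ Y)) (M₁[2]⊗M₁[1]⁻¹⊗M⁺₁ x) ⟩
  T₂ᵏ ⊗ ((M₁ (x ℤ.+ two) ⊗ B) ⊗ Y)        ≡⟨ cong (T₂ᵏ ⊗_) (⊗-assoc (M₁ (x ℤ.+ two)) B Y) ⟩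
  T₂ᵏ ⊗ (M₁ (x ℤ.+ two) ⊗ (B ⊗ Y))        ∎
  where
  T₂ᵏ U : Mat2
  T₂ᵏ = M (replicate k two)
  U = M₁ two ⊗ M₁[1]⁻¹

-- Indexed by m * 2 rather than 2 * m, since only the former reduces to suc (suc _) at suc m.
B⊗M⁺≡negM-M-dTail : ∀ m a (v : Vec ℕ (m * 2)) → All (0 <_) (a ∷ v) →
  B ⊗ (M⁺₁ (+ a) ⊗ M⁺ (map +_ (toList v))) ≡ negM (M (dTail a (toList v)))
B⊗M⁺≡negM-M-dTail zero a [] _ = begin
  B ⊗ (M⁺₁ (+ a) ⊗ I₂)                               ≡⟨ cong (B ⊗_) (⊗-identityʳ (M⁺₁ (+ a))) ⟩
  B ⊗ M⁺₁ (+ a)                                      ≡⟨ B⊗M⁺₁ a ⟩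
  -- (M₁ 1)⁻¹ = -(M₁ 1)² by computation
  M (replicate a two) ⊗ negM (M (1ℤ ∷ 1ℤ ∷ []))      ≡⟨ M⊗negM≡negM-M-++ (replicate a two) (1ℤ ∷ 1ℤ ∷ []) ⟩
  negM (M (replicate a two ++ 1ℤ ∷ 1ℤ ∷ []))         ∎
B⊗M⁺≡negM-M-dTail (suc m) (suc k) (x ∷ y ∷ v) (_ ∷ _ ∷ py ∷ pv) = begin
  B ⊗ (M⁺₁ (+ suc k) ⊗ (M⁺₁ (+ x) ⊗ (M⁺₁ (+ y) ⊗ M⁺ rest)))
    ≡⟨ B⊗M⁺₁⊗M⁺₁ k (+ x) (M⁺₁ (+ y) ⊗ M⁺ rest) ⟩
  M (replicate k two) ⊗ (M₁ (+ x ℤ.+ two) ⊗ (B ⊗ (M⁺₁ (+ y) ⊗ M⁺ rest)))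
    ≡⟨ cong (λ Z → M (replicate k two) ⊗ (M₁ (+ x ℤ.+ two) ⊗ Z)) (B⊗M⁺≡negM-M-dTail m y v (py ∷ pv)) ⟩
  M (replicate k two) ⊗ (M₁ (+ x ℤ.+ two) ⊗ negM (M (dTail y (toList v))))
    ≡⟨ cong (M (replicate k two) ⊗_) (sym (negM-distribʳ-⊗ (M₁ (+ x ℤ.+ two)) (M (dTail y (toList v))))) ⟩
  M (replicate k two) ⊗ negM (M ((+ x ℤ.+ two) ∷ dTail y (toList v)))
    ≡⟨ M⊗negM≡negM-M-++ (replicate k two) ((+ x ℤ.+ two) ∷ dTail y (toList v)) ⟩
  negM (M (dTail (suc k) (x ∷ y ∷ toList v)))
    ∎
  where
  rest : List ℤ
  rest = map +_ (toList v)

M⁺≡negM-M-dSeq : ∀ m (a : Vec ℕ (suc m * 2)) → All (0 <_) a →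
  M⁺ (map +_ (toList a)) ≡ negM (M (dSeq (toList a)))
M⁺≡negM-M-dSeq m (x ∷ y ∷ v) (_ ∷ py ∷ pv) = begin
  M⁺₁ (+ x) ⊗ (M⁺₁ (+ y) ⊗ M⁺ rest)               ≡⟨ cong (_⊗ (M⁺₁ (+ y) ⊗ M⁺ rest)) (M⁺₁≡M₁⊗B (+ x)) ⟩
  (M₁ (+ x ℤ.+ 1ℤ) ⊗ B) ⊗ (M⁺₁ (+ y) ⊗ M⁺ rest)   ≡⟨ ⊗-assoc (M₁ (+ x ℤ.+ 1ℤ)) B (M⁺₁ (+ y) ⊗ M⁺ rest) ⟩
  M₁ (+ x ℤ.+ 1ℤ) ⊗ (B ⊗ (M⁺₁ (+ y) ⊗ M⁺ rest))   ≡⟨ cong (M₁ (+ x ℤ.+ 1ℤ) ⊗_) (B⊗M⁺≡negM-M-dTail m y v (py ∷ pv)) ⟩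
  M₁ (+ x ℤ.+ 1ℤ) ⊗ negM (M (dTail y (toList v))) ≡⟨ sym (negM-distribʳ-⊗ (M₁ (+ x ℤ.+ 1ℤ)) (M (dTail y (toList v)))) ⟩
  negM (M (dSeq (x ∷ y ∷ toList v)))               ∎
  where
  rest : List ℤ
  rest = map +_ (toList v)

proposition2p5 : (m : ℕ) → 1 ≤ m → (a : Vec ℕ (2 * m)) → All (0 <_) a →
    M⁺ (map +_ (toList a)) ≡ negM (M (dSeq (toList a)))
proposition2p5 (suc m) _ a pa rewrite *-comm 2 (suc m) = M⁺≡negM-M-dSeq m a pa
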